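{- Let $\mathcal C_7=\{0,2,8,12,20,22,28,30,40,42,48,50,58,62,68\}$. For every twin-4 rank $t$ with $3t-2\geq 103$, there exist an integer $n\geq 0$ and $c\in\mathcal C_7$ with $t=5\cdot 7(2n+1)+c$; i.e. all cousin prime pairs $(3t-2,3t+2)$ with $3t-2\geq 103$ lie in the progressions $3[35(2n+1)+c]\pm 2$, $n\ge0$, $c\in\mathcal C_7$.
   Context: An odd integer $t\geq 3$ is a twin-4 rank if $3t-2$ and $3t+2$ are both prime. -}

module Defs where

open import Data.Nat using (ℕ; _+_; _*_; _∸_; _≤_)
open import Data.Nat.Primality using (Prime)
open import Data.Nat.Divisibility using (_∤_)
open import Data.Product using (_×_)
open import Data.List using (List; _∷_; [])

Odd : ℕ → Set
Odd t = 2 ∤ t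

-- An odd integer t ≥ 3 is a twin-4 rank if 3t-2 and 3t+2 are both prime.
-- (For t ≥ 3, truncated subtraction 3 * t ∸ 2 equals 3t - 2.)
Twin4Rank : ℕ → Set
Twin4Rank t = Odd t × 3 ≤ t × Prime (3 * t ∸ 2) × Prime (3 * t + 2)

C₇ : List ℕ
C₇ = 0 ∷ 2 ∷ 8 ∷ 12 ∷ 20 ∷ 22 ∷ 28 ∷ 30 ∷ 40 ∷ 42 ∷ 48 ∷ 50 ∷ 58 ∷ 62 ∷ 68 ∷ []

-- Since 3t - 2 ≥ 103 we have t ≥ 35; write t = 35 + s. The primes 3t - 2 = 103 + 3s and
-- 3t + 2 = 107 + 3s exceed 7, so neither is divisible by 5 or 7, and t is odd. These
-- conditions depend only on s modulo 70 (as 2 ∣ 70 and 5, 7 ∣ 3 · 70), and the residues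
-- c < 70 satisfying them are exactly C₇. Hence t = 35 (2n + 1) + c with n = s / 70, c = s % 70.
module Submission where

open import Defs
open import Data.Nat using (ℕ; _+_; _*_; _∸_; _≤_; _<_; NonZero; NonTrivial; _≟_)
open import Data.Nat.Properties using (*-identityˡ; *-distribˡ-+; *-cancelˡ-<; m∸n≤m; ≤-trans; m+[n∸m]≡n)
open import Data.Nat.Divisibility using (_∣_; _∤_; _∣?_; divides; ∣-trans; ∣m∣n⇒∣m+n; n∣m*n)
open import Data.Nat.DivMod using (_/_; _%_; m≡m%n+[m/n]*n; m%n<n)
open import Data.Nat.Primality using (Prime; prime⇒¬composite; prime⇒nonZero; composite-≢)
open import Data.Nat.Tactic.RingSolver using (solve-∀)
open import Data.Fin using (Fin; toℕ; fromℕ<)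
open import Data.Fin.Properties using (all?; toℕ-fromℕ<)
open import Data.Product using (Σ; _×_; _,_)
open import Data.List.Membership.Propositional using (_∈_)
open import Data.List.Membership.DecPropositional _≟_ using (_∈?_)
open import Relation.Nullary using (Dec; ¬?)
open import Relation.Nullary.Decidable using (toWitness; _×-dec_; _→-dec_)
open import Relation.Binary.PropositionalEquality using (_≡_; _≢_; refl; sym; trans; cong; subst; module ≡-Reasoning)

prime⇒∤ : ∀ {d p} → .{{NonTrivial d}} → Prime p → d ≢ p → d ∤ p
prime⇒∤ {d} pp d≢p d∣p = prime⇒¬composite pp (composite-≢ d d≢p d∣p)
  where instance _ = prime⇒nonZero pp

∣+*%⇒∣+* : ∀ {d} a k m n .{{_ : NonZero n}} →
           d ∣ k * n → d ∣ a + k * (m % n) → d ∣ a + k * m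
∣+*%⇒∣+* {d} a k m n d∣kn d∣residue =
  subst (d ∣_) shift (∣m∣n⇒∣m+n d∣residue (∣-trans d∣kn (n∣m*n (m / n))))
  where
  open ≡-Reasoning
  regroup : ∀ a k r q n → a + k * r + q * (k * n) ≡ a + k * (r + q * n)
  regroup = solve-∀
  shift : a + k * (m % n) + m / n * (k * n) ≡ a + k * m
  shift = begin
    a + k * (m % n) + m / n * (k * n)  ≡⟨ regroup a k (m % n) (m / n) n ⟩
    a + k * (m % n + m / n * n)        ≡⟨ cong (λ x → a + k * x) (m≡m%n+[m/n]*n m n) ⟨
    a + k * m                          ∎

Admissible : ℕ → Set
Admissible c = 2 ∤ 35 + c × 5 ∤ 103 + 3 * c × 7 ∤ 103 + 3 * c
                          × 5 ∤ 107 + 3 * c × 7 ∤ 107 + 3 * c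

admissible? : (c : ℕ) → Dec (Admissible c)
admissible? c = ¬? (2 ∣? 35 + c) ×-dec ¬? (5 ∣? 103 + 3 * c) ×-dec ¬? (7 ∣? 103 + 3 * c)
                   ×-dec ¬? (5 ∣? 107 + 3 * c) ×-dec ¬? (7 ∣? 107 + 3 * c)

admissible⇒∈C₇ : ∀ c → c < 70 → Admissible c → c ∈ C₇
admissible⇒∈C₇ c c<70 = subst (λ x → Admissible x → x ∈ C₇) (toℕ-fromℕ< c<70) (sieve (fromℕ< c<70))
  where
  sieve : (i : Fin 70) → Admissible (toℕ i) → toℕ i ∈ C₇
  sieve = toWitness {a? = all? (λ i → admissible? (toℕ i) →-dec (toℕ i ∈? C₇))} _

twin4Rank⇒admissible : ∀ s → Twin4Rank (35 + s) → Admissible (s % 70)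
twin4Rank⇒admissible s (odd , _ , prime₋ , prime₊) =
  odd[35+s%70] ,
  lift 103 3 5 (divides 42 refl) (prime⇒∤ prime[3t-2] λ ()) ,
  lift 103 3 7 (divides 30 refl) (prime⇒∤ prime[3t-2] λ ()) ,
  lift 107 3 5 (divides 42 refl) (prime⇒∤ prime[3t+2] λ ()) ,
  lift 107 3 7 (divides 30 refl) (prime⇒∤ prime[3t+2] λ ())
  where
  lift : ∀ a k d → d ∣ k * 70 → d ∤ a + k * s → d ∤ a + k * (s % 70)
  lift a k d d∣k70 d∤ d∣ = d∤ (∣+*%⇒∣+* a k s 70 d∣k70 d∣)
  odd[35+s%70] : 2 ∤ 35 + s % 70
  odd[35+s%70] = subst (λ x → 2 ∤ 35 + x) (*-identityˡ (s % 70))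
    (lift 35 1 2 (divides 35 refl) (subst (λ x → 2 ∤ 35 + x) (sym (*-identityˡ s)) odd))
  3t+2≡107+3s : ∀ u → 3 * (35 + u) + 2 ≡ 107 + 3 * u
  3t+2≡107+3s = solve-∀
  prime[3t-2] : Prime (103 + 3 * s)
  prime[3t-2] = subst (λ x → Prime (x ∸ 2)) (*-distribˡ-+ 3 35 s) prime₋
  prime[3t+2] : Prime (107 + 3 * s)
  prime[3t+2] = subst Prime (3t+2≡107+3s s) prime₊

35+s≡35[2[s/70]+1]+s%70 : ∀ s → 35 + s ≡ 5 * 7 * (2 * (s / 70) + 1) + s % 70
35+s≡35[2[s/70]+1]+s%70 s = trans (cong (35 +_) (m≡m%n+[m/n]*n s 70)) (regroup (s % 70) (s / 70))
  where
  regroup : ∀ r q → 35 + (r + q * 70) ≡ 5 * 7 * (2 * q + 1) + r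
  regroup = solve-∀

proposition3p5 : (t : ℕ) → Twin4Rank t → 103 ≤ 3 * t ∸ 2 →
    Σ ℕ (λ n → Σ ℕ (λ c → c ∈ C₇ × t ≡ 5 * 7 * (2 * n + 1) + c))
proposition3p5 t rank 103≤3t-2 =
  s / 70 , s % 70 ,
  admissible⇒∈C₇ (s % 70) (m%n<n s 70) (twin4Rank⇒admissible s (subst Twin4Rank t≡35+s rank)) ,
  trans t≡35+s (35+s≡35[2[s/70]+1]+s%70 s)
  where
  s = t ∸ 35
  35≤t : 35 ≤ t
  35≤t = *-cancelˡ-< 3 34 t (≤-trans 103≤3t-2 (m∸n≤m (3 * t) 2))
  t≡35+s : t ≡ 35 + s
  t≡35+s = sym (m+[n∸m]≡n 35≤t)
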